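{- Let $G$ be a finite graph of order at least $4$ which does not have balanced components. Suppose that $G$ has a vertex $v$ such that $G-v$ has balanced components and $d(v)\geq\tfrac{1}{2}|G|-1$. Let $A,B\subseteq V(G)$ be such that $|A|\geq \tfrac{1}{2}(|G|-1)$, $|B|\geq \tfrac{1}{2}(|G|-1)$ and $v \in A$. Then there is a path $P$ in $G$ starting in $A$ and ending in $B$ such that $$\Delta(G\setminus P) \leq \tfrac{1}{2}\bigl(|G\setminus P|-1\bigr).$$
   Context: A graph $G$ has balanced components if $V(G)$ can be partitioned into two sets $X$ and $Y$ with no edges between $X$ and $Y$, $|X|=\lfloor |G|/2\rfloor$ and $|Y|=\lceil |G|/2\rceil$. A single vertex is a path. $G\setminus P$ denotes the induced subgraph of $G$ on $V(G)\setminus V(P)$, $|G\setminus P|$ its number of vertices and $\Delta$ the maximum degree; the graph with no vertices is assigned maximum degree $-\tfrac12$. -}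

module Defs where

open import Data.Nat using (ℕ; zero; suc; _+_; _*_; _∸_; _≤_; _/_)
open import Data.Bool using (Bool; true; false)
open import Data.Fin using (Fin)
open import Data.Fin.Subset using (Subset; _∈_; _∉_; _⊆_; ∣_∣; _∩_; _∪_; ∁; ⁅_⁆; ⊥; ⊤)
open import Data.Vec using (tabulate)
open import Data.List using (List; []; _∷_; foldr; last)
open import Data.List.Relation.Unary.Unique.Propositional using (Unique)
open import Data.Maybe using (Maybe; just)
open import Data.Product using (Σ; ∃; _×_; _,_)
open import Relation.Binary.PropositionalEquality using (_≡_)
open import Relation.Nullary using (¬_)

record Graph (n : ℕ) : Set where
  field
    adj    : Fin n → Fin n → Bool
    sym    : ∀ x y → adj x y ≡ adj y x
    irrefl : ∀ x → adj x x ≡ false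
open Graph public

N : ∀ {n} → Graph n → Fin n → Subset n
N G v = tabulate (adj G v)

deg : ∀ {n} → Graph n → Fin n → ℕ
deg G v = ∣ N G v ∣

degIn : ∀ {n} → Graph n → Subset n → Fin n → ℕ
degIn G S v = ∣ N G v ∩ S ∣

-- The induced subgraph G[S] has balanced components: S splits into X, Y = S \ X
-- with no edges between X and Y, |X| = ⌊|S|/2⌋ (hence |Y| = ⌈|S|/2⌉).
BalancedOn : ∀ {n} → Graph n → Subset n → Set
BalancedOn G S = Σ (Subset _) λ X →
  (X ⊆ S) × (∣ X ∣ ≡ ∣ S ∣ / 2) ×
  (∀ x y → x ∈ X → y ∈ S → y ∉ X → adj G x y ≡ false)

HasBalancedComponents : ∀ {n} → Graph n → Set
HasBalancedComponents G = BalancedOn G ⊤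

data Walk {n} (G : Graph n) : List (Fin n) → Set where
  single : ∀ x → Walk G (x ∷ [])
  step   : ∀ x y ps → adj G x y ≡ true → Walk G (y ∷ ps) → Walk G (x ∷ y ∷ ps)

IsPath : ∀ {n} → Graph n → List (Fin n) → Set
IsPath G ps = Walk G ps × Unique ps

vertsOf : ∀ {n} → List (Fin n) → Subset n
vertsOf = foldr (λ x s → ⁅ x ⁆ ∪ s) ⊥

-- Δ(G[S]) ≤ (|S| - 1)/2, i.e. every vertex of S has degree d in G[S] with 2d + 1 ≤ |S|.
-- (For S empty, Δ = -1/2 by convention and the bound holds, matching vacuity.)
MaxDegBound : ∀ {n} → Graph n → Subset n → Set
MaxDegBound G S = ∀ w → w ∈ S → 2 * degIn G S w + 1 ≤ ∣ S ∣

-- Let X, Y be the balanced split of G − v. If a path P passes through v, then G ∖ P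
-- splits into X ∖ P and Y ∖ P with no edges between them, so a vertex of X ∖ P has
-- degree below |X ∖ P|, and at most its degree inside X. Hence Δ(G ∖ P) is small on
-- the X-side as soon as |X ∖ P| ≤ |Y ∖ P| + 1, or as soon as X is loose (every
-- vertex of X misses another vertex of X, so degrees inside X are at most |X| − 2)
-- and P takes few vertices. P is taken to be a route of at most three vertices
-- inside one side from A to a neighbour of v, then v, then such a route inside the
-- other side from a neighbour of v to B. Routes between any two vertices exist
-- inside a side having a universal vertex, and some neighbour of v lies in B or is
-- adjacent to B, since otherwise B would be a balanced component of G. A case
-- analysis on the parity of |G|, on which sides are loose, and on where A and B
-- meet the sides then balances the vertices taken from X and from Y.

module Submission where

open import Defs hiding (sym)
open import Data.Bool using (true; false)
import Data.Bool.Properties as Bool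
open import Data.Fin using (Fin)
import Data.Fin.Properties as Fin
open import Data.Fin.Subset using (Subset; _∈_; _∉_; _⊆_; ∣_∣; _∩_; _∪_; ∁; ⁅_⁆; ⊥; ⊤)
open import Data.Fin.Subset.Properties
open import Data.List using (List; []; _∷_; length; _++_; head; last)
open import Data.List.Membership.Propositional using () renaming (_∈_ to _∈ₗ_; _∉_ to _∉ₗ_)
open import Data.List.Membership.Propositional.Properties using (∈-++⁺ʳ)
open import Data.List.Relation.Unary.All as All using (All; []; _∷_)
open import Data.List.Relation.Unary.All.Properties using (All¬⇒¬Any)
open import Data.List.Relation.Unary.Any using (here; there)
open import Data.List.Relation.Unary.AllPairs using ([]; _∷_)
open import Data.List.Relation.Unary.Unique.Propositional using (Unique)
import Data.List.Relation.Unary.Unique.Propositional.Properties as Unique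
open import Data.Maybe using (just)
open import Data.Nat using (ℕ; suc; _+_; _*_; _≤_; _<_; _/_; _%_; s≤s; z≤n)
open import Data.Nat.DivMod using (m/n*n≤m; m*n/n≡m; /-monoˡ-≤; m≡m%n+[m/n]*n; m%n<n)
open import Data.Nat.Properties
open import Data.Nat.Tactic.RingSolver using (solve-∀)
open import Data.Product using (Σ; ∃; ∃₂; _×_; _,_; proj₁; proj₂)
open import Data.Sum using (_⊎_; inj₁; inj₂; [_,_]′) renaming (swap to swap-⊎)
open import Data.Vec using ([]; _∷_; tabulate)
open import Data.Vec.Properties using ([]=⇒lookup; lookup⇒[]=; lookup∘tabulate)
open import Relation.Binary.PropositionalEquality
open import Relation.Nullary using (¬_; Dec; yes; no; contradiction)
open import Relation.Nullary.Decidable using (_×-dec_; _⊎-dec_; ¬?; decidable-stable)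

∣p∣≡∣p∩q∣+∣p∩∁q∣ : ∀ {n} (p q : Subset n) → ∣ p ∣ ≡ ∣ p ∩ q ∣ + ∣ p ∩ ∁ q ∣
∣p∣≡∣p∩q∣+∣p∩∁q∣ []          []          = refl
∣p∣≡∣p∩q∣+∣p∩∁q∣ (true ∷ p)  (true ∷ q)  = cong suc (∣p∣≡∣p∩q∣+∣p∩∁q∣ p q)
∣p∣≡∣p∩q∣+∣p∩∁q∣ (true ∷ p)  (false ∷ q) = trans (cong suc (∣p∣≡∣p∩q∣+∣p∩∁q∣ p q)) (sym (+-suc _ _))
∣p∣≡∣p∩q∣+∣p∩∁q∣ (false ∷ p) (true ∷ q)  = ∣p∣≡∣p∩q∣+∣p∩∁q∣ p q
∣p∣≡∣p∩q∣+∣p∩∁q∣ (false ∷ p) (false ∷ q) = ∣p∣≡∣p∩q∣+∣p∩∁q∣ p q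

∣p∪q∣≤∣p∣+∣q∣ : ∀ {n} (p q : Subset n) → ∣ p ∪ q ∣ ≤ ∣ p ∣ + ∣ q ∣
∣p∪q∣≤∣p∣+∣q∣ p q = begin
  ∣ p ∪ q ∣                         ≡⟨ ∣p∣≡∣p∩q∣+∣p∩∁q∣ (p ∪ q) p ⟩
  ∣ (p ∪ q) ∩ p ∣ + ∣ (p ∪ q) ∩ ∁ p ∣ ≤⟨ +-mono-≤ (∣p∩q∣≤∣q∣ (p ∪ q) p) (p⊆q⇒∣p∣≤∣q∣ in-q) ⟩
  ∣ p ∣ + ∣ q ∣                     ∎
  where
  open ≤-Reasoning
  in-q : (p ∪ q) ∩ ∁ p ⊆ q
  in-q h with x∈p∩q⁻ (p ∪ q) (∁ p) h
  ... | h∪ , h∁ with x∈p∪q⁻ p q h∪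
  ...   | inj₁ hp = contradiction hp (x∈∁p⇒x∉p h∁)
  ...   | inj₂ hq = hq

∣p∣+∣q∣≤∣r∣ : ∀ {n} {p q r : Subset n} → p ⊆ r → q ⊆ r → (∀ {x} → x ∈ p → x ∉ q) →
              ∣ p ∣ + ∣ q ∣ ≤ ∣ r ∣
∣p∣+∣q∣≤∣r∣ {p = p} {q} {r} p⊆r q⊆r p#q = begin
  ∣ p ∣ + ∣ q ∣               ≤⟨ +-mono-≤ (p⊆q⇒∣p∣≤∣q∣ λ h → x∈p∩q⁺ (p⊆r h , h))
                                           (p⊆q⇒∣p∣≤∣q∣ λ h → x∈p∩q⁺ (q⊆r h , x∉p⇒x∈∁p λ hp → p#q hp h)) ⟩
  ∣ r ∩ p ∣ + ∣ r ∩ ∁ p ∣     ≡⟨ ∣p∣≡∣p∩q∣+∣p∩∁q∣ r p ⟨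
  ∣ r ∣                       ∎
  where open ≤-Reasoning

∃∈p∖q : ∀ {n} (p q : Subset n) → ∣ q ∣ < ∣ p ∣ → ∃ λ x → x ∈ p × x ∉ q
∃∈p∖q p q ∣q∣<∣p∣ with Fin.any? (λ x → (x ∈? p) ×-dec ¬? (x ∈? q))
... | yes (x , hp , hq) = x , hp , hq
... | no none = contradiction (p⊆q⇒∣p∣≤∣q∣ p⊆q) (<⇒≱ ∣q∣<∣p∣)
  where
  p⊆q : p ⊆ q
  p⊆q {x} hp with x ∈? q
  ... | yes hq = hq
  ... | no hq  = contradiction (x , hp , hq) none

∣p∩⁅x⁆∣≡1 : ∀ {n} {p : Subset n} {x} → x ∈ p → ∣ p ∩ ⁅ x ⁆ ∣ ≡ 1
∣p∩⁅x⁆∣≡1 {p = p} {x} x∈p =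
  trans (cong ∣_∣ (⊆-antisym (λ h → proj₂ (x∈p∩q⁻ p ⁅ x ⁆ h))
                             (λ h → x∈p∩q⁺ (subst (_∈ p) (sym (x∈⁅y⁆⇒x≡y x h)) x∈p , h))))
        (∣⁅x⁆∣≡1 x)

∣p∩⁅x⁆∣≡0 : ∀ {n} {p : Subset n} {x} → x ∉ p → ∣ p ∩ ⁅ x ⁆ ∣ ≡ 0
∣p∩⁅x⁆∣≡0 {n} {p} {x} x∉p =
  trans (cong ∣_∣ (⊆-antisym empty (λ h → contradiction h ∉⊥))) (∣⊥∣≡0 n)
  where
  empty : p ∩ ⁅ x ⁆ ⊆ ⊥
  empty h with x∈p∩q⁻ p ⁅ x ⁆ h
  ... | h₁ , h₂ = contradiction (subst (_∈ p) (x∈⁅y⁆⇒x≡y x h₂) h₁) x∉p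

∈vertsOf⇒∈ : ∀ {n} {x : Fin n} xs → x ∈ vertsOf xs → x ∈ₗ xs
∈vertsOf⇒∈ []       h = contradiction h ∉⊥
∈vertsOf⇒∈ (y ∷ xs) h with x∈p∪q⁻ ⁅ y ⁆ (vertsOf xs) h
... | inj₁ h′ = here (x∈⁅y⁆⇒x≡y y h′)
... | inj₂ h′ = there (∈vertsOf⇒∈ xs h′)

∈⇒∈vertsOf : ∀ {n} {x : Fin n} {xs} → x ∈ₗ xs → x ∈ vertsOf xs
∈⇒∈vertsOf {xs = y ∷ _} (here refl) = x∈p∪q⁺ (inj₁ (x∈⁅x⁆ y))
∈⇒∈vertsOf              (there h)   = x∈p∪q⁺ (inj₂ (∈⇒∈vertsOf h))

∣vertsOf∣≤length : ∀ {n} (xs : List (Fin n)) → ∣ vertsOf xs ∣ ≤ length xs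
∣vertsOf∣≤length {n} []       = ≤-reflexive (∣⊥∣≡0 n)
∣vertsOf∣≤length     (x ∷ xs) = begin
  ∣ ⁅ x ⁆ ∪ vertsOf xs ∣       ≤⟨ ∣p∪q∣≤∣p∣+∣q∣ ⁅ x ⁆ (vertsOf xs) ⟩
  ∣ ⁅ x ⁆ ∣ + ∣ vertsOf xs ∣   ≡⟨ cong (_+ ∣ vertsOf xs ∣) (∣⁅x⁆∣≡1 x) ⟩
  suc ∣ vertsOf xs ∣           ≤⟨ s≤s (∣vertsOf∣≤length xs) ⟩
  suc (length xs)              ∎
  where open ≤-Reasoning

countIn : ∀ {n} → Subset n → List (Fin n) → ℕ
countIn z []       = 0
countIn z (x ∷ xs) = ∣ z ∩ ⁅ x ⁆ ∣ + countIn z xs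

countIn-++ : ∀ {n} (z : Subset n) xs ys → countIn z (xs ++ ys) ≡ countIn z xs + countIn z ys
countIn-++ z []       ys = refl
countIn-++ z (x ∷ xs) ys =
  trans (cong (∣ z ∩ ⁅ x ⁆ ∣ +_) (countIn-++ z xs ys)) (sym (+-assoc ∣ z ∩ ⁅ x ⁆ ∣ _ _))

countIn-all : ∀ {n} {z : Subset n} {xs} → All (_∈ z) xs → countIn z xs ≡ length xs
countIn-all []       = refl
countIn-all (h ∷ hs) = cong₂ _+_ (∣p∩⁅x⁆∣≡1 h) (countIn-all hs)

countIn-none : ∀ {n} {z : Subset n} {xs} → All (_∉ z) xs → countIn z xs ≡ 0
countIn-none []       = refl
countIn-none (h ∷ hs) = cong₂ _+_ (∣p∩⁅x⁆∣≡0 h) (countIn-none hs)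

countIn-none-++ : ∀ {n} {z : Subset n} xs {ys} → All (_∉ z) xs → countIn z (xs ++ ys) ≡ countIn z ys
countIn-none-++ {z = z} xs {ys} out = trans (countIn-++ z xs ys) (cong (_+ countIn z ys) (countIn-none out))

countIn-++-none : ∀ {n} {z : Subset n} xs {ys} → All (_∉ z) ys → countIn z (xs ++ ys) ≡ countIn z xs
countIn-++-none {z = z} xs {ys} out =
  trans (countIn-++ z xs ys) (trans (cong (countIn z xs +_) (countIn-none out)) (+-identityʳ _))

∣z∖[x∪V]∣+∣z∩x∣≡∣z∖V∣ : ∀ {n} (z V : Subset n) {x} → x ∉ V →
                        ∣ z ∩ ∁ (⁅ x ⁆ ∪ V) ∣ + ∣ z ∩ ⁅ x ⁆ ∣ ≡ ∣ z ∩ ∁ V ∣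
∣z∖[x∪V]∣+∣z∩x∣≡∣z∖V∣ z V {x} x∉V = begin
  ∣ z ∩ ∁ (⁅ x ⁆ ∪ V) ∣ + ∣ z ∩ ⁅ x ⁆ ∣ ≡⟨ cong₂ (λ a b → ∣ a ∣ + ∣ b ∣) removed kept ⟩
  ∣ W ∩ ∁ ⁅ x ⁆ ∣ + ∣ W ∩ ⁅ x ⁆ ∣       ≡⟨ +-comm ∣ W ∩ ∁ ⁅ x ⁆ ∣ _ ⟩
  ∣ W ∩ ⁅ x ⁆ ∣ + ∣ W ∩ ∁ ⁅ x ⁆ ∣       ≡⟨ ∣p∣≡∣p∩q∣+∣p∩∁q∣ W ⁅ x ⁆ ⟨
  ∣ W ∣                               ∎
  where
  open ≡-Reasoning
  W : Subset _
  W = z ∩ ∁ V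
  removed : z ∩ ∁ (⁅ x ⁆ ∪ V) ≡ W ∩ ∁ ⁅ x ⁆
  removed = ⊆-antisym to from
    where
    to : z ∩ ∁ (⁅ x ⁆ ∪ V) ⊆ W ∩ ∁ ⁅ x ⁆
    to h with x∈p∩q⁻ z _ h
    ... | hz , h∁ = let out = x∈∁p⇒x∉p h∁ in
      x∈p∩q⁺ (x∈p∩q⁺ (hz , x∉p⇒x∈∁p (λ hV → out (x∈p∪q⁺ (inj₂ hV)))) ,
              x∉p⇒x∈∁p (λ hx → out (x∈p∪q⁺ (inj₁ hx))))
    from : W ∩ ∁ ⁅ x ⁆ ⊆ z ∩ ∁ (⁅ x ⁆ ∪ V)
    from h with x∈p∩q⁻ W _ h
    ... | hW , h∁x with x∈p∩q⁻ z _ hW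
    ...   | hz , h∁V = x∈p∩q⁺ (hz , x∉p⇒x∈∁p λ h∪ →
            [ x∈∁p⇒x∉p h∁x , x∈∁p⇒x∉p h∁V ]′ (x∈p∪q⁻ ⁅ x ⁆ V h∪))
  kept : z ∩ ⁅ x ⁆ ≡ W ∩ ⁅ x ⁆
  kept = ⊆-antisym to from
    where
    to : z ∩ ⁅ x ⁆ ⊆ W ∩ ⁅ x ⁆
    to h with x∈p∩q⁻ z _ h
    ... | hz , hx = x∈p∩q⁺ (x∈p∩q⁺ (hz , x∉p⇒x∈∁p λ hV → x∉V (subst (_∈ V) (x∈⁅y⁆⇒x≡y x hx) hV)) , hx)
    from : W ∩ ⁅ x ⁆ ⊆ z ∩ ⁅ x ⁆
    from h with x∈p∩q⁻ W _ h
    ... | hW , hx = x∈p∩q⁺ (proj₁ (x∈p∩q⁻ z _ hW) , hx)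

∣z∖xs∣+countIn≡∣z∣ : ∀ {n} (z : Subset n) {xs} → Unique xs →
                     ∣ z ∩ ∁ (vertsOf xs) ∣ + countIn z xs ≡ ∣ z ∣
∣z∖xs∣+countIn≡∣z∣ z {[]} [] = trans (+-identityʳ _) (cong ∣_∣ z∖⊥≡z)
  where
  z∖⊥≡z : z ∩ ∁ ⊥ ≡ z
  z∖⊥≡z = ⊆-antisym (λ h → proj₁ (x∈p∩q⁻ z (∁ ⊥) h)) (λ h → x∈p∩q⁺ (h , x∉p⇒x∈∁p ∉⊥))
∣z∖xs∣+countIn≡∣z∣ z {x ∷ xs} (x∉xs ∷ u) = begin
  ∣ z ∩ ∁ (⁅ x ⁆ ∪ V) ∣ + (∣ z ∩ ⁅ x ⁆ ∣ + countIn z xs)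
    ≡⟨ +-assoc ∣ z ∩ ∁ (⁅ x ⁆ ∪ V) ∣ _ _ ⟨
  ∣ z ∩ ∁ (⁅ x ⁆ ∪ V) ∣ + ∣ z ∩ ⁅ x ⁆ ∣ + countIn z xs
    ≡⟨ cong (_+ countIn z xs) (∣z∖[x∪V]∣+∣z∩x∣≡∣z∖V∣ z V (λ h → All¬⇒¬Any x∉xs (∈vertsOf⇒∈ xs h))) ⟩
  ∣ z ∩ ∁ V ∣ + countIn z xs
    ≡⟨ ∣z∖xs∣+countIn≡∣z∣ z u ⟩
  ∣ z ∣ ∎
  where
  open ≡-Reasoning
  V : Subset _
  V = vertsOf xs

∣z∖xs∣+length≡∣z∣ : ∀ {n} (z : Subset n) {xs} → Unique xs → All (_∈ z) xs →
                    ∣ z ∩ ∁ (vertsOf xs) ∣ + length xs ≡ ∣ z ∣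
∣z∖xs∣+length≡∣z∣ z {xs} u hs =
  trans (cong (∣ z ∩ ∁ (vertsOf xs) ∣ +_) (sym (countIn-all hs))) (∣z∖xs∣+countIn≡∣z∣ z u)

∣p∣+length≤∣z∣ : ∀ {n} {p z : Subset n} {xs} → Unique xs → All (_∈ z) xs →
                 p ⊆ z → (∀ {x} → x ∈ p → x ∉ₗ xs) → ∣ p ∣ + length xs ≤ ∣ z ∣
∣p∣+length≤∣z∣ {p = p} {z} {xs} u hs p⊆z p#xs = begin
  ∣ p ∣ + length xs                    ≤⟨ +-monoˡ-≤ (length xs) (p⊆q⇒∣p∣≤∣q∣ p⊆z∖xs) ⟩
  ∣ z ∩ ∁ (vertsOf xs) ∣ + length xs   ≡⟨ ∣z∖xs∣+length≡∣z∣ z u hs ⟩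
  ∣ z ∣                                ∎
  where
  open ≤-Reasoning
  p⊆z∖xs : p ⊆ z ∩ ∁ (vertsOf xs)
  p⊆z∖xs h = x∈p∩q⁺ (p⊆z h , x∉p⇒x∈∁p λ hv → p#xs h (∈vertsOf⇒∈ xs hv))

length≤∣z∣ : ∀ {n} {z : Subset n} {xs} → Unique xs → All (_∈ z) xs → length xs ≤ ∣ z ∣
length≤∣z∣ {z = z} {xs} u hs = subst (length xs ≤_) (∣z∖xs∣+length≡∣z∣ z u hs) (m≤n+m _ _)

∃∈p∖xs : ∀ {n} (p : Subset n) xs → length xs < ∣ p ∣ → ∃ λ t → t ∈ p × t ∉ₗ xs
∃∈p∖xs p xs short with ∃∈p∖q p (vertsOf xs) (≤-<-trans (∣vertsOf∣≤length xs) short)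
... | t , t∈p , t∉xs = t , t∈p , λ h → t∉xs (∈⇒∈vertsOf h)

∃∈p∖[z∖xs] : ∀ {n} (p z : Subset n) {xs} → Unique xs → All (_∈ z) xs → ∣ z ∣ < ∣ p ∣ + length xs →
             ∃ λ t → t ∈ p × (t ∉ z ⊎ t ∈ₗ xs)
∃∈p∖[z∖xs] p z {xs} u hs big with ∃∈p∖q p (z ∩ ∁ (vertsOf xs)) (+-cancelʳ-< (length xs) _ _ (begin-strict
  ∣ z ∩ ∁ (vertsOf xs) ∣ + length xs   ≡⟨ ∣z∖xs∣+length≡∣z∣ z u hs ⟩
  ∣ z ∣                                <⟨ big ⟩
  ∣ p ∣ + length xs                    ∎))
  where open ≤-Reasoning
... | t , t∈p , t∉z∖xs with t ∈? z
...   | no  t∉z = t , t∈p , inj₁ t∉z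
...   | yes t∈z = t , t∈p , inj₂ (∈vertsOf⇒∈ xs (decidable-stable (_ ∈? _)
                    λ t∉xs → t∉z∖xs (x∈p∩q⁺ (t∈z , x∉p⇒x∈∁p t∉xs))))

last-++-∷ : ∀ {a} {A : Set a} (xs : List A) y ys → last (xs ++ y ∷ ys) ≡ last (y ∷ ys)
last-++-∷ []           y ys = refl
last-++-∷ (x ∷ [])     y ys = refl
last-++-∷ (x ∷ x′ ∷ xs) y ys = last-++-∷ (x′ ∷ xs) y ys

2a≤2b+1⇒a≤b : ∀ a b → 2 * a ≤ 2 * b + 1 → a ≤ b
2a≤2b+1⇒a≤b a b 2a≤2b+1 with a ≤? b
... | yes a≤b = a≤b
... | no  a≰b = contradiction 2a≤2b+1 (<⇒≱ (begin-strict
  2 * b + 1   <⟨ ≤-reflexive (2b+2≡2[1+b] b) ⟩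
  2 * suc b   ≤⟨ *-monoʳ-≤ 2 (≰⇒> a≰b) ⟩
  2 * a       ∎))
  where
  open ≤-Reasoning
  2b+2≡2[1+b] : ∀ b → suc (2 * b + 1) ≡ 2 * suc b
  2b+2≡2[1+b] = solve-∀

n≤2b+1⇒n/2≤b : ∀ {n b} → n ≤ 2 * b + 1 → n / 2 ≤ b
n≤2b+1⇒n/2≤b {n} {b} n≤2b+1 =
  2a≤2b+1⇒a≤b (n / 2) b (≤-trans (≤-reflexive (*-comm 2 (n / 2))) (≤-trans (m/n*n≤m n 2) n≤2b+1))

2b≤n⇒b≤n/2 : ∀ {n b} → 2 * b ≤ n → b ≤ n / 2
2b≤n⇒b≤n/2 {n} {b} 2b≤n = subst (_≤ n / 2) (m*n/n≡m b 2) (/-monoˡ-≤ 2 (subst (_≤ n) (*-comm 2 b) 2b≤n))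

x≡[x+y]/2⇒y≡x∨y≡1+x : ∀ x y → x ≡ (x + y) / 2 → y ≡ x ⊎ y ≡ suc x
x≡[x+y]/2⇒y≡x∨y≡1+x x y x≡half =
  [ (λ x<y → inj₂ (≤-antisym y≤1+x x<y)) , (λ x≡y → inj₁ (sym x≡y)) ]′ (m≤n⇒m<n∨m≡n x≤y)
  where
  open ≤-Reasoning
  2x≡x+x : ∀ x → x * 2 ≡ x + x
  2x≡x+x = solve-∀
  x≤y : x ≤ y
  x≤y = +-cancelˡ-≤ x x y (begin
    x + x           ≡⟨ 2x≡x+x x ⟨
    x * 2           ≡⟨ cong (_* 2) x≡half ⟩
    (x + y) / 2 * 2 ≤⟨ m/n*n≤m (x + y) 2 ⟩
    x + y           ∎)
  y≤1+x : y ≤ suc x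
  y≤1+x = +-cancelˡ-≤ x y (suc x) (≤-pred (begin-strict
    x + y                       ≡⟨ m≡m%n+[m/n]*n (x + y) 2 ⟩
    (x + y) % 2 + (x + y) / 2 * 2 <⟨ +-monoˡ-< _ (m%n<n (x + y) 2) ⟩
    2 + (x + y) / 2 * 2         ≡⟨ cong (λ h → 2 + h * 2) x≡half ⟨
    2 + x * 2                   ≡⟨ cong (2 +_) (2x≡x+x x) ⟩
    2 + (x + x)                 ≡⟨ cong suc (+-suc x x) ⟨
    suc (x + suc x)             ∎))

balanced-sides⇒2d+1≤x+y : ∀ {d x y} i j → d + 1 ≤ x → j + (x + i) ≤ suc (i + (y + j)) →
                          2 * d + 1 ≤ x + y
balanced-sides⇒2d+1≤x+y {d} {x} {y} i j d+1≤x balanced = begin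
  2 * d + 1   ≡⟨ 2d+1≡d+1+d d ⟩
  (d + 1) + d ≤⟨ +-mono-≤ d+1≤x (≤-pred (≤-trans d<x x≤1+y)) ⟩
  x + y       ∎
  where
  open ≤-Reasoning
  2d+1≡d+1+d : ∀ d → 2 * d + 1 ≡ (d + 1) + d
  2d+1≡d+1+d = solve-∀
  d<x : d < x
  d<x = subst (_≤ x) (+-comm d 1) d+1≤x
  shuffle₁ : ∀ x i j → x + (i + j) ≡ j + (x + i)
  shuffle₁ = solve-∀
  shuffle₂ : ∀ y i j → suc (i + (y + j)) ≡ suc y + (i + j)
  shuffle₂ = solve-∀
  x≤1+y : x ≤ suc y
  x≤1+y = +-cancelʳ-≤ (i + j) x (suc y) (begin
    x + (i + j)         ≡⟨ shuffle₁ x i j ⟩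
    j + (x + i)         ≤⟨ balanced ⟩
    suc (i + (y + j))   ≡⟨ shuffle₂ y i j ⟩
    suc y + (i + j)     ∎)

loose-side⇒2d+1≤x+y : ∀ {d x y} i j → d + 2 ≤ x + i → i + j + (x + i) ≤ 3 + (y + j) →
                      2 * d + 1 ≤ x + y
loose-side⇒2d+1≤x+y {d} {x} {y} i j d+2≤p small = +-cancelʳ-≤ (3 + j) (2 * d + 1) (x + y) (begin
  2 * d + 1 + (3 + j)         ≡⟨ shuffle₁ d j ⟩
  (d + 2) + (d + 2) + j       ≤⟨ +-monoˡ-≤ j (+-mono-≤ d+2≤p d+2≤p) ⟩
  (x + i) + (x + i) + j       ≡⟨ shuffle₂ x i j ⟩
  x + (i + j + (x + i))       ≤⟨ +-monoʳ-≤ x small ⟩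
  x + (3 + (y + j))           ≡⟨ shuffle₃ x y j ⟩
  x + y + (3 + j)             ∎)
  where
  open ≤-Reasoning
  shuffle₁ : ∀ d j → 2 * d + 1 + (3 + j) ≡ (d + 2) + (d + 2) + j
  shuffle₁ = solve-∀
  shuffle₂ : ∀ x i j → (x + i) + (x + i) + j ≡ x + (i + j + (x + i))
  shuffle₂ = solve-∀
  shuffle₃ : ∀ x y j → x + (3 + (y + j)) ≡ x + y + (3 + j)
  shuffle₃ = solve-∀

module _ {n} (G : Graph n) where

  adj⇒∈N : ∀ {w x} → adj G w x ≡ true → x ∈ N G w
  adj⇒∈N {w} {x} e = lookup⇒[]= x (tabulate (adj G w)) (trans (lookup∘tabulate (adj G w) x) e)

  ∈N⇒adj : ∀ {w x} → x ∈ N G w → adj G w x ≡ true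
  ∈N⇒adj {w} {x} h = trans (sym (lookup∘tabulate (adj G w) x)) ([]=⇒lookup h)

  ∉N⇒¬adj : ∀ {w x} → x ∉ N G w → adj G w x ≡ false
  ∉N⇒¬adj h = Bool.¬-not λ e → h (adj⇒∈N e)

  adj-sym : ∀ {a b} → adj G a b ≡ true → adj G b a ≡ true
  adj-sym {a} {b} e = trans (Graph.sym G b a) e

  adj⇒≢ : ∀ {a b} → adj G a b ≡ true → a ≢ b
  adj⇒≢ {a} e refl = Bool.not-¬ e (Graph.irrefl G a)

  w∉N[w] : ∀ w → w ∉ N G w
  w∉N[w] w h = adj⇒≢ (∈N⇒adj h) refl

  ∈N[w]⇒≢w : ∀ {w x} → x ∈ N G w → x ≢ w
  ∈N[w]⇒≢w h refl = w∉N[w] _ h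

  Universal : Subset n → Fin n → Set
  Universal z u = u ∈ z × (∀ {x} → x ∈ z → x ≢ u → adj G u x ≡ true)

  HasNonNeighbourIn : Subset n → Fin n → Set
  HasNonNeighbourIn z w = ∃ λ x → x ∈ z × x ≢ w × adj G w x ≡ false

  hasNonNeighbourIn? : ∀ z w → Dec (HasNonNeighbourIn z w)
  hasNonNeighbourIn? z w =
    Fin.any? λ x → (x ∈? z) ×-dec ¬? (x Fin.≟ w) ×-dec (adj G w x Bool.≟ false)

  Loose : Subset n → Set
  Loose z = ∀ {w} → w ∈ z → HasNonNeighbourIn z w

  universal-or-loose : ∀ z → ∃ (Universal z) ⊎ Loose z
  universal-or-loose z with Fin.any? (λ w → (w ∈? z) ×-dec ¬? (hasNonNeighbourIn? z w))
  ... | yes (u , u∈z , none) = inj₁ (u , u∈z , adjacent)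
    where
    adjacent : ∀ {x} → x ∈ z → x ≢ u → adj G u x ≡ true
    adjacent {x} x∈z x≢u = Bool.¬-not λ e → none (x , x∈z , x≢u , e)
  ... | no ¬u = inj₂ loose
    where
    loose : Loose z
    loose {w} w∈z with hasNonNeighbourIn? z w
    ... | yes found = found
    ... | no none   = contradiction (w , w∈z , none) ¬u

  loose⇒∣N∩z∣+2≤∣z∣ : ∀ {z} → Loose z → ∀ {w} → w ∈ z → ∣ N G w ∩ z ∣ + 2 ≤ ∣ z ∣
  loose⇒∣N∩z∣+2≤∣z∣ {z} loose {w} w∈z with loose w∈z
  ... | x , x∈z , x≢w , ¬adj =
    ∣p∣+length≤∣z∣ ((≢-sym x≢w ∷ []) ∷ [] ∷ []) (w∈z ∷ x∈z ∷ []) (λ h → proj₂ (x∈p∩q⁻ _ z h)) avoids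
    where
    avoids : ∀ {y} → y ∈ N G w ∩ z → y ∉ₗ w ∷ x ∷ []
    avoids h (here refl)         = w∉N[w] w (proj₁ (x∈p∩q⁻ _ z h))
    avoids h (there (here refl)) = Bool.not-¬ (∈N⇒adj (proj₁ (x∈p∩q⁻ _ z h))) ¬adj

closed⇒balanced : ∀ {n} (G : Graph n) (Z : Subset n) → n ≤ 2 * ∣ Z ∣ + 1 → 2 * ∣ Z ∣ ≤ n →
                  (∀ {a b} → a ∈ Z → b ∉ Z → adj G a b ≡ false) → HasBalancedComponents G
closed⇒balanced {n} G Z lo hi closed = Z , (λ _ → ∈⊤) , ∣Z∣≡n/2 , λ _ _ a∈Z _ b∉Z → closed a∈Z b∉Z
  where
  ∣Z∣≡n/2 : ∣ Z ∣ ≡ ∣ ⊤ {n} ∣ / 2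
  ∣Z∣≡n/2 = trans (≤-antisym (2b≤n⇒b≤n/2 hi) (n≤2b+1⇒n/2≤b lo)) (cong (_/ 2) (sym (∣⊤∣≡n n)))

data Route {n} (G : Graph n) (Z : Subset n) : Fin n → Fin n → List (Fin n) → Set where
  route₁ : ∀ {a} → a ∈ Z → Route G Z a a (a ∷ [])
  route₂ : ∀ {a b} → a ∈ Z → b ∈ Z → adj G a b ≡ true → Route G Z a b (a ∷ b ∷ [])
  route₃ : ∀ {a u b} → a ∈ Z → u ∈ Z → b ∈ Z → adj G a u ≡ true → adj G u b ≡ true → a ≢ b →
           Route G Z a b (a ∷ u ∷ b ∷ [])

module _ {n} {G : Graph n} {Z : Subset n} where

  route-⊆ : ∀ {a b L} → Route G Z a b L → All (_∈ Z) L
  route-⊆ (route₁ a∈Z)               = a∈Z ∷ []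
  route-⊆ (route₂ a∈Z b∈Z _)         = a∈Z ∷ b∈Z ∷ []
  route-⊆ (route₃ a∈Z u∈Z b∈Z _ _ _) = a∈Z ∷ u∈Z ∷ b∈Z ∷ []

  route-unique : ∀ {a b L} → Route G Z a b L → Unique L
  route-unique (route₁ _)               = [] ∷ []
  route-unique (route₂ _ _ e)           = (adj⇒≢ G e ∷ []) ∷ [] ∷ []
  route-unique (route₃ _ _ _ e₁ e₂ a≢b) = (adj⇒≢ G e₁ ∷ a≢b ∷ []) ∷ (adj⇒≢ G e₂ ∷ []) ∷ [] ∷ []

  route-length≥1 : ∀ {a b L} → Route G Z a b L → 1 ≤ length L
  route-length≥1 (route₁ _)           = s≤s z≤n
  route-length≥1 (route₂ _ _ _)       = s≤s z≤n
  route-length≥1 (route₃ _ _ _ _ _ _) = s≤s z≤n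

  route-length≤3 : ∀ {a b L} → Route G Z a b L → length L ≤ 3
  route-length≤3 (route₁ _)           = s≤s z≤n
  route-length≤3 (route₂ _ _ _)       = s≤s (s≤s z≤n)
  route-length≤3 (route₃ _ _ _ _ _ _) = ≤-refl

route-length≥2 : ∀ {n} {G : Graph n} {Z a b L} → a ≢ b → Route G Z a b L → 2 ≤ length L
route-length≥2 a≢b (route₁ _)           = contradiction refl a≢b
route-length≥2 a≢b (route₂ _ _ _)       = s≤s (s≤s z≤n)
route-length≥2 a≢b (route₃ _ _ _ _ _ _) = s≤s (s≤s z≤n)

route-length≤∣Z∣ : ∀ {n} {G : Graph n} {Z a b L} → Route G Z a b L → length L ≤ ∣ Z ∣
route-length≤∣Z∣ r = length≤∣z∣ (route-unique r) (route-⊆ r)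

route-via : ∀ {n} {G : Graph n} {Z u} → Universal G Z u → ∀ {a b} → a ∈ Z → b ∈ Z → ∃ (Route G Z a b)
route-via {G = G} {Z} {u} (u∈Z , u-adj) {a} {b} a∈Z b∈Z with a Fin.≟ b | adj G a b in a~b
... | yes refl | _     = _ , route₁ a∈Z
... | no  a≢b  | true  = _ , route₂ a∈Z b∈Z a~b
... | no  a≢b  | false = _ , route₃ a∈Z u∈Z b∈Z (adj-sym G (u-adj a∈Z a≢u)) (u-adj b∈Z b≢u) a≢b
  where
  a≢u : a ≢ u
  a≢u refl = Bool.not-¬ (u-adj b∈Z (≢-sym a≢b)) a~b
  b≢u : b ≢ u
  b≢u refl = Bool.not-¬ (adj-sym G (u-adj a∈Z a≢b)) a~b

record Split {n} (G : Graph n) (v : Fin n) : Set where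
  field
    X Y         : Subset n
    v∉X         : v ∉ X
    v∉Y         : v ∉ Y
    X∩Y≡∅       : ∀ {t} → t ∈ X → t ∉ Y
    X∪Y≡V-v     : ∀ {t} → t ≢ v → t ∈ X ⊎ t ∈ Y
    X-Y-nonadj  : ∀ {a b} → a ∈ X → b ∈ Y → adj G a b ≡ false

  ∉X⇒∈Y : ∀ {t} → t ≢ v → t ∉ X → t ∈ Y
  ∉X⇒∈Y t≢v t∉X with X∪Y≡V-v t≢v
  ... | inj₁ t∈X = contradiction t∈X t∉X
  ... | inj₂ t∈Y = t∈Y

  neighbour-in-X : ∀ {a b} → a ∈ X → adj G a b ≡ true → b ≢ v → b ∈ X
  neighbour-in-X a∈X e b≢v with X∪Y≡V-v b≢v
  ... | inj₁ b∈X = b∈X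
  ... | inj₂ b∈Y = contradiction (X-Y-nonadj a∈X b∈Y) (Bool.not-¬ e)

swap : ∀ {n} {G : Graph n} {v} → Split G v → Split G v
swap {G = G} s = record
  { X = Y ; Y = X ; v∉X = v∉Y ; v∉Y = v∉X
  ; X∩Y≡∅ = λ t∈Y t∈X → X∩Y≡∅ t∈X t∈Y
  ; X∪Y≡V-v = λ t≢v → swap-⊎ (X∪Y≡V-v t≢v)
  ; X-Y-nonadj = λ a∈Y b∈X → trans (Graph.sym G _ _) (X-Y-nonadj b∈X a∈Y) }
  where open Split s

-- p and q are the sizes of the side Z and of the other side, i and j the numbers of
-- their vertices on the path.
SideOK : ∀ {n} → Graph n → Subset n → (p q i j : ℕ) → Set
SideOK G Z p q i j = j + p ≤ suc (i + q) ⊎ (Loose G Z × i + j + p ≤ 3 + q)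

module _ {n} {G : Graph n} {v} (s : Split G v) where
  open Split s

  ∣S∣≡∣X∩S∣+∣Y∩S∣ : ∀ {S} → v ∉ S → ∣ S ∣ ≡ ∣ X ∩ S ∣ + ∣ Y ∩ S ∣
  ∣S∣≡∣X∩S∣+∣Y∩S∣ {S} v∉S = trans (∣p∣≡∣p∩q∣+∣p∩∁q∣ S X) (cong₂ _+_ (cong ∣_∣ (∩-comm S X)) (cong ∣_∣ S∖X≡Y∩S))
    where
    S∖X≡Y∩S : S ∩ ∁ X ≡ Y ∩ S
    S∖X≡Y∩S = ⊆-antisym to from
      where
      to : S ∩ ∁ X ⊆ Y ∩ S
      to {t} h with x∈p∩q⁻ S (∁ X) h
      ... | t∈S , t∉X with X∪Y≡V-v {t} (λ { refl → v∉S t∈S })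
      ...   | inj₁ t∈X = contradiction t∈X (x∈∁p⇒x∉p t∉X)
      ...   | inj₂ t∈Y = x∈p∩q⁺ (t∈Y , t∈S)
      from : Y ∩ S ⊆ S ∩ ∁ X
      from h with x∈p∩q⁻ Y S h
      ... | t∈Y , t∈S = x∈p∩q⁺ (t∈S , x∉p⇒x∈∁p λ t∈X → X∩Y≡∅ t∈X t∈Y)

  X-side-deg-bound : ∀ {S i j} → v ∉ S → ∣ X ∩ S ∣ + i ≡ ∣ X ∣ → ∣ Y ∩ S ∣ + j ≡ ∣ Y ∣ →
                     SideOK G X ∣ X ∣ ∣ Y ∣ i j → ∀ {w} → w ∈ X → w ∈ S → 2 * degIn G S w + 1 ≤ ∣ S ∣
  X-side-deg-bound {S} {i} {j} v∉S eX eY ok {w} w∈X w∈S =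
    subst (2 * degIn G S w + 1 ≤_) (sym (∣S∣≡∣X∩S∣+∣Y∩S∣ v∉S))
          (bound (subst₂ (λ p q → SideOK G X p q i j) (sym eX) (sym eY) ok))
    where
    N∩S⊆X : N G w ∩ S ⊆ X
    N∩S⊆X {t} h with x∈p∩q⁻ (N G w) S h
    ... | t∈N , t∈S = neighbour-in-X w∈X (∈N⇒adj G t∈N) (λ { refl → v∉S t∈S })
    deg+1≤∣X∩S∣ : degIn G S w + 1 ≤ ∣ X ∩ S ∣
    deg+1≤∣X∩S∣ = ∣p∣+length≤∣z∣ ([] ∷ []) (x∈p∩q⁺ (w∈X , w∈S) ∷ []) in-X∩S avoid-w
      where
      in-X∩S : N G w ∩ S ⊆ X ∩ S
      in-X∩S h = x∈p∩q⁺ (N∩S⊆X h , proj₂ (x∈p∩q⁻ (N G w) S h))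
      avoid-w : ∀ {t} → t ∈ N G w ∩ S → t ∉ₗ w ∷ []
      avoid-w h (here refl) = w∉N[w] G w (proj₁ (x∈p∩q⁻ (N G w) S h))
    bound : SideOK G X (∣ X ∩ S ∣ + i) (∣ Y ∩ S ∣ + j) i j → 2 * degIn G S w + 1 ≤ ∣ X ∩ S ∣ + ∣ Y ∩ S ∣
    bound (inj₁ balanced)        = balanced-sides⇒2d+1≤x+y i j deg+1≤∣X∩S∣ balanced
    bound (inj₂ (loose , small)) = loose-side⇒2d+1≤x+y i j
      (≤-trans (+-monoˡ-≤ 2 (p⊆q⇒∣p∣≤∣q∣ λ h → x∈p∩q⁺ (proj₁ (x∈p∩q⁻ (N G w) S h) , N∩S⊆X h)))
               (subst (∣ N G w ∩ X ∣ + 2 ≤_) (sym eX) (loose⇒∣N∩z∣+2≤∣z∣ G loose w∈X)))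
      small

open Split

maxDegBound : ∀ {n} {G : Graph n} {v} (s : Split G v) →
              ∀ {S i j} → v ∉ S → ∣ X s ∩ S ∣ + i ≡ ∣ X s ∣ → ∣ Y s ∩ S ∣ + j ≡ ∣ Y s ∣ →
              SideOK G (X s) ∣ X s ∣ ∣ Y s ∣ i j → SideOK G (Y s) ∣ Y s ∣ ∣ X s ∣ j i → MaxDegBound G S
maxDegBound s v∉S eX eY okX okY w w∈S with X∪Y≡V-v s {w} (λ { refl → v∉S w∈S })
... | inj₁ w∈X = X-side-deg-bound s v∉S eX eY okX w∈X w∈S
... | inj₂ w∈Y = X-side-deg-bound (swap s) v∉S eY eX okY w∈Y w∈S

GoodPath : ∀ {n} → Graph n → Subset n → Subset n → Set
GoodPath {n} G A B = Σ (Fin n) λ a → Σ (List (Fin n)) λ rest →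
  IsPath G (a ∷ rest) × a ∈ A ×
  Σ (Fin n) (λ b → (last (a ∷ rest) ≡ just b) × b ∈ B) ×
  MaxDegBound G (∁ (vertsOf (a ∷ rest)))

module Through {n} (G : Graph n) (v : Fin n) (A B : Subset n) where

  data Entry (Z : Subset n) : List (Fin n) → Set where
    start-at-v : v ∈ A → Entry Z []
    enter      : ∀ {a c L} → a ∈ A → Route G Z a c L → adj G c v ≡ true → Entry Z L

  data Exit (Z : Subset n) : List (Fin n) → Set where
    stop-at-v : v ∈ B → Exit Z []
    leave     : ∀ {c b L} → adj G v c ≡ true → Route G Z c b L → b ∈ B → Exit Z L

  module _ {Z : Subset n} where

    entry-⊆ : ∀ {L} → Entry Z L → All (_∈ Z) L
    entry-⊆ (start-at-v _) = []
    entry-⊆ (enter _ r _)  = route-⊆ r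

    exit-⊆ : ∀ {L} → Exit Z L → All (_∈ Z) L
    exit-⊆ (stop-at-v _) = []
    exit-⊆ (leave _ r _) = route-⊆ r

    entry-unique : ∀ {L} → Entry Z L → Unique L
    entry-unique (start-at-v _) = []
    entry-unique (enter _ r _)  = route-unique r

    exit-unique : ∀ {L} → Exit Z L → Unique L
    exit-unique (stop-at-v _) = []
    exit-unique (leave _ r _) = route-unique r

    exit-walk : ∀ {L} → Exit Z L → Walk G (v ∷ L)
    exit-walk (stop-at-v _)                      = single v
    exit-walk (leave e (route₁ _) _)             = step _ _ _ e (single _)
    exit-walk (leave e (route₂ _ _ e₁) _)        = step _ _ _ e (step _ _ _ e₁ (single _))
    exit-walk (leave e (route₃ _ _ _ e₁ e₂ _) _) = step _ _ _ e (step _ _ _ e₁ (step _ _ _ e₂ (single _)))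

    entry-walk : ∀ {L L′} → Entry Z L → Walk G (v ∷ L′) → Walk G (L ++ v ∷ L′)
    entry-walk (start-at-v _)                     w = w
    entry-walk (enter _ (route₁ _) e)             w = step _ _ _ e w
    entry-walk (enter _ (route₂ _ _ e₁) e)        w = step _ _ _ e₁ (step _ _ _ e w)
    entry-walk (enter _ (route₃ _ _ _ e₁ e₂ _) e) w = step _ _ _ e₁ (step _ _ _ e₂ (step _ _ _ e w))

    entry-head : ∀ {L} L′ → Entry Z L → ∃ λ a → head (L ++ v ∷ L′) ≡ just a × a ∈ A
    entry-head L′ (start-at-v v∈A)                   = v , refl , v∈A
    entry-head L′ (enter a∈A (route₁ _) _)           = _ , refl , a∈A
    entry-head L′ (enter a∈A (route₂ _ _ _) _)       = _ , refl , a∈A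
    entry-head L′ (enter a∈A (route₃ _ _ _ _ _ _) _) = _ , refl , a∈A

    exit-last : ∀ {L} → Exit Z L → ∃ λ b → last (v ∷ L) ≡ just b × b ∈ B
    exit-last (stop-at-v v∈B)                    = v , refl , v∈B
    exit-last (leave _ (route₁ _) b∈B)           = _ , refl , b∈B
    exit-last (leave _ (route₂ _ _ _) b∈B)       = _ , refl , b∈B
    exit-last (leave _ (route₃ _ _ _ _ _ _) b∈B) = _ , refl , b∈B

  goodPath : ∀ {P} → IsPath G P → (∃ λ a → head P ≡ just a × a ∈ A) →
             (∃ λ b → last P ≡ just b × b ∈ B) → MaxDegBound G (∁ (vertsOf P)) → GoodPath G A B
  goodPath {a ∷ rest} path (.a , refl , a∈A) end bound = a , rest , path , a∈A , end , bound

  through-v : (s : Split G v) → ∀ {p q L₁ L₂} → ∣ X s ∣ ≡ p → ∣ Y s ∣ ≡ q →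
              Entry (Y s) L₁ → Exit (X s) L₂ →
              SideOK G (X s) p q (length L₂) (length L₁) → SideOK G (Y s) q p (length L₁) (length L₂) →
              GoodPath G A B
  through-v s {L₁ = L₁} {L₂} refl refl entry exit okX okY =
    goodPath (walk , unique) (entry-head L₂ entry) end
             (maxDegBound s v∉S (removed (X s) countX) (removed (Y s) countY) okX okY)
    where
    P : List (Fin n)
    P = L₁ ++ v ∷ L₂
    walk : Walk G P
    walk = entry-walk entry (exit-walk exit)
    end : ∃ λ b → last P ≡ just b × b ∈ B
    end with exit-last exit
    ... | b , last≡b , b∈B = b , trans (last-++-∷ L₁ v L₂) last≡b , b∈B
    L₁⊆Y : All (_∈ Y s) L₁
    L₁⊆Y = entry-⊆ entry
    L₂⊆X : All (_∈ X s) L₂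
    L₂⊆X = exit-⊆ exit
    unique : Unique P
    unique = Unique.++⁺ (entry-unique entry)
                        (All.map (λ { t∈X refl → v∉X s t∈X }) L₂⊆X ∷ exit-unique exit)
                        disjoint
      where
      disjoint : ∀ {t} → ¬ (t ∈ₗ L₁ × t ∈ₗ v ∷ L₂)
      disjoint (t∈L₁ , here refl)  = v∉Y s (All.lookup L₁⊆Y t∈L₁)
      disjoint (t∈L₁ , there t∈L₂) = X∩Y≡∅ s (All.lookup L₂⊆X t∈L₂) (All.lookup L₁⊆Y t∈L₁)
    v∉S : v ∉ ∁ (vertsOf P)
    v∉S h = x∈∁p⇒x∉p h (∈⇒∈vertsOf (∈-++⁺ʳ L₁ (here refl)))
    removed : ∀ Z {k} → countIn Z P ≡ k → ∣ Z ∩ ∁ (vertsOf P) ∣ + k ≡ ∣ Z ∣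
    removed Z refl = ∣z∖xs∣+countIn≡∣z∣ Z unique
    countX : countIn (X s) P ≡ length L₂
    countX = trans (countIn-none-++ L₁ (All.map (λ t∈Y t∈X → X∩Y≡∅ s t∈X t∈Y) L₁⊆Y))
                   (cong₂ _+_ (∣p∩⁅x⁆∣≡0 (v∉X s)) (countIn-all L₂⊆X))
    countY : countIn (Y s) P ≡ length L₁
    countY = trans (countIn-++-none L₁ (v∉Y s ∷ All.map (X∩Y≡∅ s) L₂⊆X)) (countIn-all L₁⊆Y)

module Analysis {n} (G : Graph n) (unbalanced : ¬ HasBalancedComponents G) (v : Fin n) {A B : Subset n}
                (v∈A : v ∈ A) (v∉B : v ∉ B)
                (deg-bound : n ≤ 2 * deg G v + 2) (B-bound : n ≤ 2 * ∣ B ∣ + 1) where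

  open Through G v A B

  side-meets-N : (s : Split G v) → n ≤ 2 * ∣ X s ∣ + 1 → 2 * ∣ X s ∣ ≤ n → ∃ λ c → c ∈ X s × c ∈ N G v
  side-meets-N s lo hi with Fin.any? (λ c → (c ∈? X s) ×-dec (c ∈? N G v))
  ... | yes found = found
  ... | no none   = contradiction (closed⇒balanced G (X s) lo hi closed) unbalanced
    where
    closed : ∀ {a b} → a ∈ X s → b ∉ X s → adj G a b ≡ false
    closed {a} {b} a∈X b∉X with b Fin.≟ v
    ... | yes refl = trans (Graph.sym G a v) (∉N⇒¬adj G λ a∈N → none (a , a∈X , a∈N))
    ... | no b≢v   = X-Y-nonadj s a∈X (∉X⇒∈Y s b≢v b∉X)

  N∩B≡∅ : Set
  N∩B≡∅ = ∀ {c} → c ∈ N G v → c ∉ B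

  ∣N∣+∣B∣+length≤n : N∩B≡∅ → ∀ {xs} → Unique xs →
                     (∀ {t} → t ∈ N G v → t ∉ₗ xs) → (∀ {t} → t ∈ B → t ∉ₗ xs) →
                     ∣ N G v ∣ + ∣ B ∣ + length xs ≤ n
  ∣N∣+∣B∣+length≤n disjoint {xs} u N#xs B#xs = begin
    ∣ N G v ∣ + ∣ B ∣ + length xs
      ≤⟨ +-monoˡ-≤ (length xs) (∣p∣+∣q∣≤∣r∣ (outside N#xs) (outside B#xs) disjoint) ⟩
    ∣ ⊤ ∩ ∁ (vertsOf xs) ∣ + length xs ≡⟨ ∣z∖xs∣+length≡∣z∣ ⊤ u (All.tabulate λ _ → ∈⊤) ⟩
    ∣ ⊤ {n} ∣                          ≡⟨ ∣⊤∣≡n n ⟩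
    n                                  ∎
    where
    open ≤-Reasoning
    outside : ∀ {p} → (∀ {t} → t ∈ p → t ∉ₗ xs) → p ⊆ ⊤ ∩ ∁ (vertsOf xs)
    outside p#xs h = x∈p∩q⁺ (∈⊤ , x∉p⇒x∈∁p λ hv → p#xs h (∈vertsOf⇒∈ xs hv))

  n≤∣N∣+∣B∣+1 : n ≤ ∣ N G v ∣ + ∣ B ∣ + 1
  n≤∣N∣+∣B∣+1 = 2a≤2b+1⇒a≤b n _ (begin
    2 * n                                    ≡⟨ 2n≡n+n n ⟩
    n + n                                    ≤⟨ +-mono-≤ deg-bound B-bound ⟩
    2 * deg G v + 2 + (2 * ∣ B ∣ + 1)        ≡⟨ regroup (deg G v) ∣ B ∣ ⟩
    2 * (deg G v + ∣ B ∣ + 1) + 1            ∎)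
    where
    open ≤-Reasoning
    2n≡n+n : ∀ n → 2 * n ≡ n + n
    2n≡n+n = solve-∀
    regroup : ∀ d b → 2 * d + 2 + (2 * b + 1) ≡ 2 * (d + b + 1) + 1
    regroup = solve-∀

  N∪B-covers : N∩B≡∅ → ∀ {t} → t ≢ v → t ∈ N G v ⊎ t ∈ B
  N∪B-covers disjoint {t} t≢v with t ∈? N G v | t ∈? B
  ... | yes t∈N | _       = inj₁ t∈N
  ... | no _    | yes t∈B = inj₂ t∈B
  ... | no t∉N  | no t∉B  = contradiction n≤∣N∣+∣B∣+1 (<⇒≱ (begin-strict
    ∣ N G v ∣ + ∣ B ∣ + 1   <⟨ ≤-reflexive (sym (+-suc (∣ N G v ∣ + ∣ B ∣) 1)) ⟩
    ∣ N G v ∣ + ∣ B ∣ + 2   ≤⟨ ∣N∣+∣B∣+length≤n disjoint ((≢-sym t≢v ∷ []) ∷ [] ∷ []) N#vt B#vt ⟩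
    n                       ∎))
    where
    open ≤-Reasoning
    N#vt : ∀ {x} → x ∈ N G v → x ∉ₗ v ∷ t ∷ []
    N#vt x∈N (here refl)         = w∉N[w] G v x∈N
    N#vt x∈N (there (here refl)) = t∉N x∈N
    B#vt : ∀ {x} → x ∈ B → x ∉ₗ v ∷ t ∷ []
    B#vt x∈B (here refl)         = v∉B x∈B
    B#vt x∈B (there (here refl)) = t∉B x∈B

  N-meets-or-touches-B : (∃ λ c → c ∈ N G v × c ∈ B) ⊎
                         (N∩B≡∅ × ∃₂ λ c b → c ∈ N G v × b ∈ B × adj G c b ≡ true)
  N-meets-or-touches-B with Fin.any? (λ c → (c ∈? N G v) ×-dec (c ∈? B))
  ... | yes meet = inj₁ meet
  ... | no ¬meet with Fin.any? (λ c → (c ∈? N G v) ×-dec Fin.any? λ b → (b ∈? B) ×-dec (adj G c b Bool.≟ true))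
  ...   | yes (c , c∈N , b , b∈B , c~b) = inj₂ (disjoint , c , b , c∈N , b∈B , c~b)
    where
    disjoint : N∩B≡∅
    disjoint c∈N c∈B = ¬meet (_ , c∈N , c∈B)
  ...   | no ¬touch = contradiction (closed⇒balanced G B B-bound 2∣B∣≤n closed) unbalanced
    where
    disjoint : N∩B≡∅
    disjoint c∈N c∈B = ¬meet (_ , c∈N , c∈B)
    closed : ∀ {a b} → a ∈ B → b ∉ B → adj G a b ≡ false
    closed {a} {b} a∈B b∉B with b Fin.≟ v
    ... | yes refl = trans (Graph.sym G a v) (∉N⇒¬adj G λ a∈N → disjoint a∈N a∈B)
    ... | no b≢v with N∪B-covers disjoint b≢v
    ...   | inj₂ b∈B = contradiction b∈B b∉B
    ...   | inj₁ b∈N = trans (Graph.sym G a b) (Bool.¬-not λ b~a → ¬touch (b , b∈N , a , a∈B , b~a))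
    ∣N∣+∣B∣+1≤n : ∣ N G v ∣ + ∣ B ∣ + 1 ≤ n
    ∣N∣+∣B∣+1≤n = ∣N∣+∣B∣+length≤n disjoint ([] ∷ [])
      (λ { x∈N (here refl) → w∉N[w] G v x∈N }) (λ { x∈B (here refl) → v∉B x∈B })
    2∣B∣≤n : 2 * ∣ B ∣ ≤ n
    2∣B∣≤n = +-cancelʳ-≤ (2 * deg G v + 2) (2 * ∣ B ∣) n (begin
      2 * ∣ B ∣ + (2 * deg G v + 2)   ≡⟨ regroup ∣ B ∣ (deg G v) ⟩
      2 * (deg G v + ∣ B ∣ + 1)       ≤⟨ *-monoʳ-≤ 2 ∣N∣+∣B∣+1≤n ⟩
      2 * n                           ≡⟨ 2n≡n+n n ⟩
      n + n                           ≤⟨ +-monoʳ-≤ n deg-bound ⟩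
      n + (2 * deg G v + 2)           ∎)
      where
      open ≤-Reasoning
      regroup : ∀ b d → 2 * b + (2 * d + 2) ≡ 2 * (d + b + 1)
      regroup = solve-∀
      2n≡n+n : ∀ n → 2 * n ≡ n + n
      2n≡n+n = solve-∀

  ∈B⇒≢v : ∀ {b} → b ∈ B → b ≢ v
  ∈B⇒≢v b∈B refl = v∉B b∈B

  edge-exit : (s : Split G v) → ∀ {c b} → c ∈ X s → c ∈ N G v → b ∈ B → adj G c b ≡ true →
              Exit (X s) (c ∷ b ∷ [])
  edge-exit s c∈X c∈N b∈B c~b =
    leave (∈N⇒adj G c∈N) (route₂ c∈X (neighbour-in-X s c∈X c~b (∈B⇒≢v b∈B)) c~b) b∈B

  near-hub : ∀ {Z u x} → Universal G Z u → x ∈ Z → x ≡ u ⊎ adj G u x ≡ true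
  near-hub {u = u} {x} (_ , u-adj) x∈Z with x Fin.≟ u
  ... | yes x≡u = inj₁ x≡u
  ... | no  x≢u = inj₂ (u-adj x∈Z x≢u)

  ShortExit : Subset n → Set
  ShortExit Z = ∃₂ λ c b → c ∈ Z × b ∈ Z × c ∈ N G v × b ∈ B × (c ≡ b ⊎ adj G c b ≡ true)

  shortExit? : ∀ Z → Dec (ShortExit Z)
  shortExit? Z = Fin.any? λ c → Fin.any? λ b →
    (c ∈? Z) ×-dec (b ∈? Z) ×-dec (c ∈? N G v) ×-dec (b ∈? B) ×-dec ((c Fin.≟ b) ⊎-dec (adj G c b Bool.≟ true))

  ShortExit⇒Exit : ∀ {Z} → ShortExit Z → ∃ λ L → Exit Z L × 1 ≤ length L × length L ≤ 2
  ShortExit⇒Exit (c , .c , c∈Z , _ , c∈N , c∈B , inj₁ refl) =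
    _ , leave (∈N⇒adj G c∈N) (route₁ c∈Z) c∈B , s≤s z≤n , s≤s z≤n
  ShortExit⇒Exit (c , b , c∈Z , b∈Z , c∈N , b∈B , inj₂ c~b) =
    _ , leave (∈N⇒adj G c∈N) (route₂ c∈Z b∈Z c~b) b∈B , s≤s z≤n , s≤s (s≤s z≤n)

  short-exit-somewhere : (s : Split G v) → ShortExit (X s) ⊎ ShortExit (Y s)
  short-exit-somewhere s with N-meets-or-touches-B
  ... | inj₁ (c , c∈N , c∈B) with X∪Y≡V-v s (∈N[w]⇒≢w G c∈N)
  ...   | inj₁ c∈X = inj₁ (c , c , c∈X , c∈X , c∈N , c∈B , inj₁ refl)
  ...   | inj₂ c∈Y = inj₂ (c , c , c∈Y , c∈Y , c∈N , c∈B , inj₁ refl)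
  short-exit-somewhere s | inj₂ (_ , c , b , c∈N , b∈B , c~b) with X∪Y≡V-v s (∈N[w]⇒≢w G c∈N)
  ...   | inj₁ c∈X = inj₁ (c , b , c∈X , neighbour-in-X s c∈X c~b (∈B⇒≢v b∈B) , c∈N , b∈B , inj₂ c~b)
  ...   | inj₂ c∈Y = inj₂ (c , b , c∈Y , neighbour-in-X (swap s) c∈Y c~b (∈B⇒≢v b∈B) , c∈N , b∈B , inj₂ c~b)

  module Odd (m : ℕ) (n≡2m+1 : n ≡ 2 * m + 1) (2≤m : 2 ≤ m) (m≤∣A∣ : m ≤ ∣ A ∣) (m≤∣B∣ : m ≤ ∣ B ∣) where

    X-meets-N : (s : Split G v) → ∣ X s ∣ ≡ m → ∃ λ c → c ∈ X s × c ∈ N G v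
    X-meets-N s ∣X∣≡m = side-meets-N s
      (subst (λ k → n ≤ 2 * k + 1) (sym ∣X∣≡m) (≤-reflexive n≡2m+1))
      (subst (λ k → 2 * k ≤ n) (sym ∣X∣≡m) (≤-trans (m≤m+n (2 * m) 1) (≤-reflexive (sym n≡2m+1))))

    path-via-meeting-vertex : (s : Split G v) → ∣ X s ∣ ≡ m → ∣ Y s ∣ ≡ m →
                         ∀ {c} → c ∈ X s → c ∈ N G v → c ∈ B → GoodPath G A B
    path-via-meeting-vertex s eX eY c∈X c∈N c∈B =
      through-v s eX eY (start-at-v v∈A) (leave (∈N⇒adj G c∈N) (route₁ c∈X) c∈B)
                (inj₁ (m≤n+m m 2)) (inj₁ ≤-refl)

    path-entering-via-hub : (s : Split G v) → ∣ X s ∣ ≡ m → ∣ Y s ∣ ≡ m → ∀ {u a c b} →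
                    Universal G (Y s) u → a ∈ A → a ∈ Y s → Exit (X s) (c ∷ b ∷ []) → GoodPath G A B
    path-entering-via-hub s eX eY Y-univ a∈A a∈Y exit with X-meets-N (swap s) eY
    ... | c′ , c′∈Y , c′∈N with route-via Y-univ a∈Y c′∈Y
    ...   | _ , r = through-v s eX eY (enter a∈A r (adj-sym G (∈N⇒adj G c′∈N))) exit
                              (inj₁ (+-monoˡ-≤ m (route-length≤3 r)))
                              (inj₁ (s≤s (+-monoˡ-≤ m (route-length≥1 r))))

    B-meets-Y : (s : Split G v) → ∣ X s ∣ ≡ m → N∩B≡∅ →
                ∀ {c} → c ∈ X s → c ∈ N G v → ∃ λ b → b ∈ Y s × b ∈ B
    B-meets-Y s eX disjoint {c} c∈X c∈N
      with ∃∈p∖[z∖xs] B (X s) {c ∷ []} ([] ∷ []) (c∈X ∷ [])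
             (subst (_< ∣ B ∣ + 1) (sym eX) (≤-trans (s≤s m≤∣B∣) (≤-reflexive (+-comm 1 ∣ B ∣))))
    ... | b , b∈B , inj₁ b∉X         = b , ∉X⇒∈Y s (∈B⇒≢v b∈B) b∉X , b∈B
    ... | b , b∈B , inj₂ (here refl) = contradiction b∈B (disjoint c∈N)

    A-meets-X : (s : Split G v) → (∀ {a} → a ∈ A → a ∉ Y s) → ∃ λ a → a ∈ A × a ∈ X s
    A-meets-X s A∩Y≡∅ with ∃∈p∖xs A (v ∷ []) (≤-trans 2≤m m≤∣A∣)
    ... | a , a∈A , a∉[v] with X∪Y≡V-v s {a} (λ { refl → a∉[v] (here refl) })
    ...   | inj₁ a∈X = a , a∈A , a∈X
    ...   | inj₂ a∈Y = contradiction a∈Y (A∩Y≡∅ a∈A)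

    path-when-A∩Y≡∅ : (s : Split G v) → ∣ X s ∣ ≡ m → ∣ Y s ∣ ≡ m → N∩B≡∅ →
                  ∀ {c u} → c ∈ X s → c ∈ N G v → Universal G (Y s) u → (∀ {a} → a ∈ A → a ∉ Y s) →
                  GoodPath G A B
    path-when-A∩Y≡∅ s eX eY disjoint c∈X c∈N Y-univ A∩Y≡∅
      with B-meets-Y s eX disjoint c∈X c∈N | X-meets-N (swap s) eY | universal-or-loose G (X s)
    ... | b , b∈Y , b∈B | c′ , c′∈Y , c′∈N | inj₂ X-loose with route-via Y-univ c′∈Y b∈Y
    ...   | _ , r = through-v (swap s) eY eX (start-at-v v∈A) (leave (∈N⇒adj G c′∈N) r b∈B)
                              (inj₁ (m≤n+m m (suc _))) (inj₂ (X-loose , +-monoˡ-≤ m (route-length≤3 r)))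
    path-when-A∩Y≡∅ s eX eY disjoint c∈X c∈N (u∈Y , u-adj) A∩Y≡∅
        | b , b∈Y , b∈B | c′ , c′∈Y , c′∈N | inj₁ (_ , X-univ)
      with A-meets-X s A∩Y≡∅ | N∪B-covers disjoint (λ { refl → v∉Y s u∈Y })
    ... | a , a∈A , a∈X | inj₁ u∈N = path-entering-via-hub (swap s) eY eX X-univ a∈A a∈X
          (leave (∈N⇒adj G u∈N) (route₂ u∈Y b∈Y (u-adj b∈Y λ { refl → disjoint u∈N b∈B })) b∈B)
    ... | a , a∈A , a∈X | inj₂ u∈B = path-entering-via-hub (swap s) eY eX X-univ a∈A a∈X
          (leave (∈N⇒adj G c′∈N) (route₂ c′∈Y u∈Y (adj-sym G (u-adj c′∈Y λ { refl → disjoint c′∈N u∈B }))) u∈B)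

    path-via-touching-edge : (s : Split G v) → ∣ X s ∣ ≡ m → ∣ Y s ∣ ≡ m → N∩B≡∅ →
                        ∀ {c b} → c ∈ X s → c ∈ N G v → b ∈ B → adj G c b ≡ true → GoodPath G A B
    path-via-touching-edge s eX eY disjoint c∈X c∈N b∈B c~b with universal-or-loose G (Y s)
    ... | inj₂ Y-loose = through-v s eX eY (start-at-v v∈A) (edge-exit s c∈X c∈N b∈B c~b)
                                   (inj₁ (m≤n+m m 3)) (inj₂ (Y-loose , n≤1+n (2 + m)))
    ... | inj₁ (_ , Y-univ) with Fin.any? (λ a → (a ∈? A) ×-dec (a ∈? Y s))
    ...   | yes (a , a∈A , a∈Y) = path-entering-via-hub s eX eY Y-univ a∈A a∈Y (edge-exit s c∈X c∈N b∈B c~b)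
    ...   | no ¬A∩Y = path-when-A∩Y≡∅ s eX eY disjoint c∈X c∈N Y-univ λ a∈A a∈Y → ¬A∩Y (_ , a∈A , a∈Y)

    odd-path : (s : Split G v) → ∣ X s ∣ ≡ m → ∣ Y s ∣ ≡ m → GoodPath G A B
    odd-path s eX eY with N-meets-or-touches-B
    ... | inj₁ (c , c∈N , c∈B) with X∪Y≡V-v s (∈N[w]⇒≢w G c∈N)
    ...   | inj₁ c∈X = path-via-meeting-vertex s eX eY c∈X c∈N c∈B
    ...   | inj₂ c∈Y = path-via-meeting-vertex (swap s) eY eX c∈Y c∈N c∈B
    odd-path s eX eY | inj₂ (disjoint , c , b , c∈N , b∈B , c~b) with X∪Y≡V-v s (∈N[w]⇒≢w G c∈N)
    ...   | inj₁ c∈X = path-via-touching-edge s eX eY disjoint c∈X c∈N b∈B c~b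
    ...   | inj₂ c∈Y = path-via-touching-edge (swap s) eY eX disjoint c∈Y c∈N b∈B c~b

  module Even (m : ℕ) (n≡2m+2 : n ≡ 2 * m + 2) (m≤∣N∣ : m ≤ ∣ N G v ∣)
              (1+m≤∣A∣ : suc m ≤ ∣ A ∣) (1+m≤∣B∣ : suc m ≤ ∣ B ∣)
              (s : Split G v) (∣X∣≡m : ∣ X s ∣ ≡ m) (∣Y∣≡1+m : ∣ Y s ∣ ≡ suc m) where

    Y-meets-N : ∃ λ c → c ∈ Y s × c ∈ N G v
    Y-meets-N = side-meets-N (swap s)
      (subst (λ k → n ≤ 2 * k + 1) (sym ∣Y∣≡1+m) (≤-trans (≤-reflexive n≡2[1+m]) (m≤m+n _ 1)))
      (subst (λ k → 2 * k ≤ n) (sym ∣Y∣≡1+m) (≤-reflexive (sym n≡2[1+m])))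
      where
      2m+2≡2[1+m] : ∀ m → 2 * m + 2 ≡ 2 * suc m
      2m+2≡2[1+m] = solve-∀
      n≡2[1+m] : n ≡ 2 * suc m
      n≡2[1+m] = trans n≡2m+2 (2m+2≡2[1+m] m)

    B-meets-Y : ∃ λ b → b ∈ Y s × b ∈ B
    B-meets-Y with ∃∈p∖[z∖xs] B (X s) {[]} [] []
                     (subst₂ _<_ (sym ∣X∣≡m) (sym (+-identityʳ ∣ B ∣)) 1+m≤∣B∣)
    ... | b , b∈B , inj₁ b∉X = b , ∉X⇒∈Y s (∈B⇒≢v b∈B) b∉X , b∈B

    path-via-short-exit-in-Y : ShortExit (Y s) → GoodPath G A B
    path-via-short-exit-in-Y Y-exit with ShortExit⇒Exit Y-exit
    ... | _ , exit , _ , k≤2 = through-v (swap s) ∣Y∣≡1+m ∣X∣≡m (start-at-v v∈A) exit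
                                         (inj₁ (s≤s (m≤n+m m _))) (inj₁ (+-monoˡ-≤ m k≤2))

    path-when-Y-loose : ¬ ShortExit (Y s) → Loose G (Y s) → GoodPath G A B
    path-when-Y-loose ¬Y-exit Y-loose with short-exit-somewhere s
    ... | inj₂ Y-exit = contradiction Y-exit ¬Y-exit
    ... | inj₁ X-exit with ShortExit⇒Exit X-exit
    ...   | _ , exit , _ , k≤2 = through-v s ∣X∣≡m ∣Y∣≡1+m (start-at-v v∈A) exit
                                           (inj₁ (m≤n⇒m≤o+n (suc _) (n≤1+n m)))
                                           (inj₂ (Y-loose , +-monoˡ-≤ (suc m) k≤2))

    module HubInY (¬Y-exit : ¬ ShortExit (Y s)) {u} (Y-univ : Universal G (Y s) u)
                  {c} (c∈Y : c ∈ Y s) (c∈N : c ∈ N G v) {b} (b∈Y : b ∈ Y s) (b∈B : b ∈ B) where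

      u∈Y : u ∈ Y s
      u∈Y = proj₁ Y-univ

      u-adj : ∀ {x} → x ∈ Y s → x ≢ u → adj G u x ≡ true
      u-adj = proj₂ Y-univ

      c≢b : c ≢ b
      c≢b refl = ¬Y-exit (c , c , c∈Y , c∈Y , c∈N , b∈B , inj₁ refl)

      u∉N : u ∉ N G v
      u∉N u∈N with near-hub Y-univ b∈Y
      ... | inj₁ refl = ¬Y-exit (b , b , b∈Y , b∈Y , u∈N , b∈B , inj₁ refl)
      ... | inj₂ u~b  = ¬Y-exit (u , b , u∈Y , b∈Y , u∈N , b∈B , inj₂ u~b)

      u∉B : u ∉ B
      u∉B u∈B with near-hub Y-univ c∈Y
      ... | inj₁ refl = ¬Y-exit (c , c , c∈Y , c∈Y , c∈N , u∈B , inj₁ refl)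
      ... | inj₂ u~c  = ¬Y-exit (c , u , c∈Y , u∈Y , c∈N , u∈B , inj₂ (adj-sym G u~c))

      c≢u : c ≢ u
      c≢u refl = u∉N c∈N

      b≢u : b ≢ u
      b≢u refl = u∉B b∈B

      hub-route : Route G (Y s) c b (c ∷ u ∷ b ∷ [])
      hub-route = route₃ c∈Y u∈Y b∈Y (adj-sym G (u-adj c∈Y c≢u)) (u-adj b∈Y b≢u) c≢b

      hub-exit : Exit (Y s) (c ∷ u ∷ b ∷ [])
      hub-exit = leave (∈N⇒adj G c∈N) hub-route b∈B

      2≤m : 2 ≤ m
      2≤m = ≤-pred (≤-trans (route-length≤∣Z∣ hub-route) (≤-reflexive ∣Y∣≡1+m))

      X-meets-N : ∃ λ c′ → c′ ∈ X s × c′ ∈ N G v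
      X-meets-N with ∃∈p∖[z∖xs] (N G v) (Y s) {u ∷ b ∷ []} ((≢-sym b≢u ∷ []) ∷ [] ∷ []) (u∈Y ∷ b∈Y ∷ [])
                       (subst (_< ∣ N G v ∣ + 2) (sym ∣Y∣≡1+m)
                              (≤-trans (≤-reflexive (+-comm 2 m)) (+-monoˡ-≤ 2 m≤∣N∣)))
      ... | t , t∈N , inj₁ t∉Y                 = t , ∉X⇒∈Y (swap s) (∈N[w]⇒≢w G t∈N) t∉Y , t∈N
      ... | t , t∈N , inj₂ (here refl)         = contradiction t∈N u∉N
      ... | t , t∈N , inj₂ (there (here refl)) =
        contradiction (b , b , b∈Y , b∈Y , t∈N , b∈B , inj₁ refl) ¬Y-exit

      path-when-X-loose : Loose G (X s) → GoodPath G A B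
      path-when-X-loose X-loose = through-v (swap s) ∣Y∣≡1+m ∣X∣≡m (start-at-v v∈A) hub-exit
                                  (inj₁ (m≤n+m (suc m) 3)) (inj₂ (X-loose , n≤1+n (3 + m)))

      path-entering-from-X : ∀ {w a} → Universal G (X s) w → a ∈ A → a ∈ X s → GoodPath G A B
      path-entering-from-X X-univ a∈A a∈X with X-meets-N
      ... | c′ , c′∈X , c′∈N with route-via X-univ a∈X c′∈X
      ...   | _ , r = through-v (swap s) ∣Y∣≡1+m ∣X∣≡m (enter a∈A r (adj-sym G (∈N⇒adj G c′∈N))) hub-exit
                                (inj₁ (+-monoˡ-≤ (suc m) (route-length≤3 r)))
                                (inj₁ (s≤s (+-monoˡ-≤ (suc m) (route-length≥1 r))))

      A-meets-Y-avoiding : ∀ xs → length xs < ∣ A ∣ → (∀ {a} → a ∈ A → a ∉ X s) → v ∈ₗ xs →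
                        ∃ λ a → a ∈ A × a ∈ Y s × a ∉ₗ xs
      A-meets-Y-avoiding xs short A∩X≡∅ v∈xs with ∃∈p∖xs A xs short
      ... | a , a∈A , a∉xs = a , a∈A , ∉X⇒∈Y s (λ { refl → a∉xs v∈xs }) (A∩X≡∅ a∈A) , a∉xs

      path-when-A∩X≡∅-with-X-exit : (∀ {a} → a ∈ A → a ∉ X s) → ShortExit (X s) → GoodPath G A B
      path-when-A∩X≡∅-with-X-exit A∩X≡∅ X-exit
        with ShortExit⇒Exit X-exit
           | A-meets-Y-avoiding (v ∷ c ∷ []) (≤-trans (s≤s 2≤m) 1+m≤∣A∣) A∩X≡∅ (here refl)
      ... | _ , exit , 1≤k , k≤2 | a , a∈A , a∈Y , a∉vc with route-via Y-univ a∈Y c∈Y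
      ...   | _ , r = through-v s ∣X∣≡m ∣Y∣≡1+m (enter a∈A r (adj-sym G (∈N⇒adj G c∈N))) exit
                        (inj₁ (≤-trans (+-monoˡ-≤ m (route-length≤3 r)) (s≤s (+-monoˡ-≤ (suc m) 1≤k))))
                        (inj₁ (≤-trans (+-monoˡ-≤ (suc m) k≤2) (s≤s (+-monoˡ-≤ m (route-length≥2 a≢c r)))))
        where
        a≢c : a ≢ c
        a≢c refl = a∉vc (there (here refl))

      B-meets-X : ∃ λ b′ → b′ ∈ X s × b′ ∈ B
      B-meets-X with ∃∈p∖[z∖xs] B (Y s) {u ∷ c ∷ []} ((≢-sym c≢u ∷ []) ∷ [] ∷ []) (u∈Y ∷ c∈Y ∷ [])
                       (subst (_< ∣ B ∣ + 2) (sym ∣Y∣≡1+m)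
                              (≤-trans (≤-reflexive (+-comm 2 m)) (+-monoˡ-≤ 2 (≤-trans (n≤1+n m) 1+m≤∣B∣))))
      ... | t , t∈B , inj₁ t∉Y                 = t , ∉X⇒∈Y (swap s) (∈B⇒≢v t∈B) t∉Y , t∈B
      ... | t , t∈B , inj₂ (here refl)         = contradiction t∈B u∉B
      ... | t , t∈B , inj₂ (there (here refl)) =
        contradiction (c , c , c∈Y , c∈Y , c∈N , t∈B , inj₁ refl) ¬Y-exit

      path-when-A∩X≡∅-without-X-exit : ∀ {w} → Universal G (X s) w → (∀ {a} → a ∈ A → a ∉ X s) →
                                       ¬ ShortExit (X s) → GoodPath G A B
      path-when-A∩X≡∅-without-X-exit X-univ A∩X≡∅ ¬X-exit with X-meets-N | B-meets-X
      ... | c′ , c′∈X , c′∈N | b′ , b′∈X , b′∈B with route-via X-univ c′∈X b′∈X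
      ...   | _ , route₁ _ = contradiction (c′ , c′ , c′∈X , c′∈X , c′∈N , b′∈B , inj₁ refl) ¬X-exit
      ...   | _ , route₂ _ _ c′~b′ = contradiction (c′ , b′ , c′∈X , b′∈X , c′∈N , b′∈B , inj₂ c′~b′) ¬X-exit
      ...   | _ , r@(route₃ _ _ _ _ _ _)
        with A-meets-Y-avoiding (v ∷ u ∷ c ∷ [])
               (≤-trans (s≤s (≤-trans (route-length≤∣Z∣ r) (≤-reflexive ∣X∣≡m))) 1+m≤∣A∣) A∩X≡∅ (here refl)
      ...     | a , a∈A , a∈Y , a∉vuc =
        -- the route through the hub of X has three vertices, so |A| > m ≥ 3
        through-v s ∣X∣≡m ∣Y∣≡1+m (enter a∈A entry (adj-sym G (∈N⇒adj G c∈N))) (leave (∈N⇒adj G c′∈N) r b′∈B)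
                  (inj₁ (m≤n+m (3 + m) 2)) (inj₁ ≤-refl)
        where
        a≢u : a ≢ u
        a≢u refl = a∉vuc (there (here refl))
        entry : Route G (Y s) a c (a ∷ u ∷ c ∷ [])
        entry = route₃ a∈Y u∈Y c∈Y (adj-sym G (u-adj a∈Y a≢u)) (u-adj c∈Y c≢u)
                       (λ { refl → a∉vuc (there (there (here refl))) })

      path : GoodPath G A B
      path with universal-or-loose G (X s)
      ... | inj₂ X-loose = path-when-X-loose X-loose
      ... | inj₁ (_ , X-univ) with Fin.any? (λ a → (a ∈? A) ×-dec (a ∈? X s))
      ...   | yes (_ , a∈A , a∈X) = path-entering-from-X X-univ a∈A a∈X
      ...   | no ¬A∩X with shortExit? (X s)
      ...     | yes X-exit = path-when-A∩X≡∅-with-X-exit (λ a∈A a∈X → ¬A∩X (_ , a∈A , a∈X)) X-exit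
      ...     | no ¬X-exit = path-when-A∩X≡∅-without-X-exit X-univ (λ a∈A a∈X → ¬A∩X (_ , a∈A , a∈X)) ¬X-exit

    even-path : GoodPath G A B
    even-path with shortExit? (Y s)
    ... | yes Y-exit = path-via-short-exit-in-Y Y-exit
    ... | no ¬Y-exit with universal-or-loose G (Y s)
    ...   | inj₂ Y-loose = path-when-Y-loose ¬Y-exit Y-loose
    ...   | inj₁ (_ , Y-univ) with Y-meets-N | B-meets-Y
    ...     | _ , c∈Y , c∈N | _ , b∈Y , b∈B = HubInY.path ¬Y-exit Y-univ c∈Y c∈N b∈Y b∈B

split-of-balanced : ∀ {n} {G : Graph n} {v} → BalancedOn G (∁ ⁅ v ⁆) →
                    Σ (Split G v) λ s → ∣ X s ∣ ≡ (∣ X s ∣ + ∣ Y s ∣) / 2 × n ≡ ∣ X s ∣ + ∣ Y s ∣ + 1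
split-of-balanced {n} {G} {v} (X′ , X′⊆V-v , ∣X′∣≡half , X′-closed) =
  s , trans ∣X′∣≡half (cong (_/ 2) ∣V-v∣≡∣X′∣+∣Y′∣) , n≡
  where
  V-v : Subset n
  V-v = ∁ ⁅ v ⁆
  Y′ : Subset n
  Y′ = V-v ∩ ∁ X′
  s : Split G v
  s = record
    { X = X′ ; Y = Y′
    ; v∉X = λ v∈X′ → x∈∁p⇒x∉p (X′⊆V-v v∈X′) (x∈⁅x⁆ v)
    ; v∉Y = λ v∈Y′ → x∈∁p⇒x∉p (proj₁ (x∈p∩q⁻ V-v (∁ X′) v∈Y′)) (x∈⁅x⁆ v)
    ; X∩Y≡∅ = λ t∈X′ t∈Y′ → x∈∁p⇒x∉p (proj₂ (x∈p∩q⁻ V-v (∁ X′) t∈Y′)) t∈X′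
    ; X∪Y≡V-v = cover
    ; X-Y-nonadj = λ a∈X′ b∈Y′ → let b∈V-v , b∉X′ = x∈p∩q⁻ V-v (∁ X′) b∈Y′ in
                     X′-closed _ _ a∈X′ b∈V-v (x∈∁p⇒x∉p b∉X′) }
    where
    cover : ∀ {t} → t ≢ v → t ∈ X′ ⊎ t ∈ Y′
    cover {t} t≢v with t ∈? X′
    ... | yes t∈X′ = inj₁ t∈X′
    ... | no  t∉X′ = inj₂ (x∈p∩q⁺ (x∉p⇒x∈∁p (λ t∈⁅v⁆ → t≢v (x∈⁅y⁆⇒x≡y v t∈⁅v⁆)) , x∉p⇒x∈∁p t∉X′))
  ∣V-v∣≡∣X′∣+∣Y′∣ : ∣ V-v ∣ ≡ ∣ X′ ∣ + ∣ Y′ ∣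
  ∣V-v∣≡∣X′∣+∣Y′∣ = trans (∣p∣≡∣p∩q∣+∣p∩∁q∣ V-v X′)
                          (cong (λ p → ∣ p ∣ + ∣ Y′ ∣) (⊆-antisym (λ h → proj₂ (x∈p∩q⁻ V-v X′ h))
                                                                  (λ h → x∈p∩q⁺ (X′⊆V-v h , h))))
  n≡ : n ≡ ∣ X′ ∣ + ∣ Y′ ∣ + 1
  n≡ = begin
    n                             ≡⟨ ∣⊤∣≡n n ⟨
    ∣ ⊤ {n} ∣                     ≡⟨ ∣p∣≡∣p∩q∣+∣p∩∁q∣ ⊤ ⁅ v ⁆ ⟩
    ∣ ⊤ ∩ ⁅ v ⁆ ∣ + ∣ ⊤ ∩ V-v ∣   ≡⟨ cong₂ _+_ (∣p∩⁅x⁆∣≡1 {p = ⊤} {x = v} ∈⊤) (cong ∣_∣ (∩-identityˡ V-v)) ⟩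
    1 + ∣ V-v ∣                   ≡⟨ +-comm 1 ∣ V-v ∣ ⟩
    ∣ V-v ∣ + 1                   ≡⟨ cong (_+ 1) ∣V-v∣≡∣X′∣+∣Y′∣ ⟩
    ∣ X′ ∣ + ∣ Y′ ∣ + 1           ∎
    where open ≡-Reasoning

path-at-v : ∀ {n} {G : Graph n} {v A B} (s : Split G v) → ∣ Y s ∣ ≡ ∣ X s ∣ ⊎ ∣ Y s ∣ ≡ suc ∣ X s ∣ →
            v ∈ A → v ∈ B → GoodPath G A B
path-at-v {G = G} {v} {A} {B} s sizes v∈A v∈B =
  through-v s refl refl (start-at-v v∈A) (stop-at-v v∈B) (inj₁ (X-small sizes)) (inj₁ (Y-small sizes))
  where
  open Through G v A B
  X-small : ∣ Y s ∣ ≡ ∣ X s ∣ ⊎ ∣ Y s ∣ ≡ suc ∣ X s ∣ → ∣ X s ∣ ≤ suc ∣ Y s ∣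
  X-small (inj₁ y≡x)   = ≤-trans (n≤1+n _) (s≤s (≤-reflexive (sym y≡x)))
  X-small (inj₂ y≡1+x) = ≤-trans (m≤n+m _ 2) (s≤s (≤-reflexive (sym y≡1+x)))
  Y-small : ∣ Y s ∣ ≡ ∣ X s ∣ ⊎ ∣ Y s ∣ ≡ suc ∣ X s ∣ → ∣ Y s ∣ ≤ suc ∣ X s ∣
  Y-small (inj₁ y≡x)   = ≤-trans (≤-reflexive y≡x) (n≤1+n _)
  Y-small (inj₂ y≡1+x) = ≤-reflexive y≡1+x

module _ {n} (G : Graph n) (unbalanced : ¬ HasBalancedComponents G) (v : Fin n) {A B : Subset n}
         (v∈A : v ∈ A) (v∉B : v ∉ B) (deg-bound : n ≤ 2 * deg G v + 2)
         (A-bound : n ≤ 2 * ∣ A ∣ + 1) (B-bound : n ≤ 2 * ∣ B ∣ + 1) (s : Split G v) where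

  open Analysis G unbalanced v v∈A v∉B deg-bound B-bound

  odd-order-path : 4 ≤ n → n ≡ ∣ X s ∣ + ∣ Y s ∣ + 1 → ∣ Y s ∣ ≡ ∣ X s ∣ → GoodPath G A B
  odd-order-path 4≤n n≡x+y+1 y≡x =
    Odd.odd-path m n≡2m+1 (2a≤2b+1⇒a≤b 2 m (≤-trans 4≤n (≤-reflexive n≡2m+1)))
                 (half-bound A-bound) (half-bound B-bound) s refl y≡x
    where
    m : ℕ
    m = ∣ X s ∣
    x+x+1≡2x+1 : ∀ x → x + x + 1 ≡ 2 * x + 1
    x+x+1≡2x+1 = solve-∀
    n≡2m+1 : n ≡ 2 * m + 1
    n≡2m+1 = trans n≡x+y+1 (trans (cong (λ y → m + y + 1) y≡x) (x+x+1≡2x+1 m))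
    half-bound : ∀ {k} → n ≤ 2 * k + 1 → m ≤ k
    half-bound n≤2k+1 =
      2a≤2b+1⇒a≤b m _ (≤-trans (m≤m+n (2 * m) 1) (≤-trans (≤-reflexive (sym n≡2m+1)) n≤2k+1))

  even-order-path : n ≡ ∣ X s ∣ + ∣ Y s ∣ + 1 → ∣ Y s ∣ ≡ suc ∣ X s ∣ → GoodPath G A B
  even-order-path n≡x+y+1 y≡1+x =
    Even.even-path m n≡2m+2 m≤∣N∣ (half-bound A-bound) (half-bound B-bound) s refl y≡1+x
    where
    m : ℕ
    m = ∣ X s ∣
    x+[1+x]+1≡2x+2 : ∀ x → x + suc x + 1 ≡ 2 * x + 2
    x+[1+x]+1≡2x+2 = solve-∀
    2x+2≡2[1+x] : ∀ x → 2 * x + 2 ≡ 2 * suc x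
    2x+2≡2[1+x] = solve-∀
    n≡2m+2 : n ≡ 2 * m + 2
    n≡2m+2 = trans n≡x+y+1 (trans (cong (λ y → m + y + 1) y≡1+x) (x+[1+x]+1≡2x+2 m))
    half-bound : ∀ {k} → n ≤ 2 * k + 1 → suc m ≤ k
    half-bound n≤2k+1 =
      2a≤2b+1⇒a≤b (suc m) _ (≤-trans (≤-reflexive (sym (trans n≡2m+2 (2x+2≡2[1+x] m)))) n≤2k+1)
    m≤∣N∣ : m ≤ ∣ N G v ∣
    m≤∣N∣ = *-cancelˡ-≤ 2 (+-cancelʳ-≤ 2 (2 * m) (2 * deg G v)
                                       (≤-trans (≤-reflexive (sym n≡2m+2)) deg-bound))

lemma3p4 : ∀ {n} (G : Graph n) →
    4 ≤ n →
    ¬ HasBalancedComponents G →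
    (v : Fin n) →
    BalancedOn G (∁ ⁅ v ⁆) →
    n ≤ 2 * deg G v + 2 →
    (A B : Subset n) →
    n ≤ 2 * ∣ A ∣ + 1 →
    n ≤ 2 * ∣ B ∣ + 1 →
    v ∈ A →
    Σ (Fin n) λ a → Σ (List (Fin n)) λ rest →
      IsPath G (a ∷ rest) × a ∈ A ×
      Σ (Fin n) (λ b → (last (a ∷ rest) ≡ just b) × b ∈ B) ×
      MaxDegBound G (∁ (vertsOf (a ∷ rest)))
lemma3p4 G 4≤n unbalanced v balanced deg-bound A B A-bound B-bound v∈A
  with split-of-balanced balanced
... | s , x≡[x+y]/2 , n≡x+y+1 with x≡[x+y]/2⇒y≡x∨y≡1+x _ _ x≡[x+y]/2 | v ∈? B
...   | sizes      | yes v∈B = path-at-v s sizes v∈A v∈B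
...   | inj₁ y≡x   | no v∉B  =
  odd-order-path G unbalanced v v∈A v∉B deg-bound A-bound B-bound s 4≤n n≡x+y+1 y≡x
...   | inj₂ y≡1+x | no v∉B  =
  even-order-path G unbalanced v v∈A v∉B deg-bound A-bound B-bound s n≡x+y+1 y≡1+x
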